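{- Let $\lambda/\mu$ be a skew shape with $r$ rows and $c$ columns. For $a\in[r+1,r+c]$ let $I_a=R(\rho_a)\cup C(\rho_a)$, where $\rho_a$ is the $a$-extremal non-nesting rook placement on $\lambda/\mu$, and for a row index $b\in[1,r]$ put $\ell_{a,b}=|I_a\cap[1,b]|$. If $\ell_{a,b}=0$, then $(b,a-1)\notin\lambda/\mu$.
   Context: Rows of $\lambda/\mu$ are labelled $1,\dots,r$ top to bottom, columns $r+1,\dots,r+c$ left to right; the skew shape is the set of cells $\{(i,r+j):1\le i\le r,\ \mu_i<j\le\lambda_i\}$, every row and column assumed nonempty. A rook placement is a set of cells, no two in the same row or column; it is non-nesting if no two rooks $(i,j),(k,\ell)$ satisfy $i<k$, $j<\ell$. $R(\rho)$ denotes the set of occupied rows and $C(\rho)$ the set of unoccupied columns of $\rho$. The $i$-extremal non-nesting rook placement, for a column index $i\in[r+1,r+c]$: leave columns $i,i+1,\dots,r+c$ unoccupied, and for $j=1,\dots,r$ in turn place a rook in row $j$ as far to the right as possible while keeping those columns unoccupied and keeping the configuration non-attacking and non-nesting. (For a row index $i\in[1,r]$: place a rook in the last cell of row $i$, then for $j=i+1,\dots,r$ place a rook in row $j$ as far right as possible keeping the non-nesting condition, continuing until a rook is placed in the last row $r$ or the first column $r+1$.) The sets $I_1,\dots,I_{r+c}$ form the Grassmann necklace of the rook matroid of $\lambda/\mu$. -}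

module Defs where

open import Data.Nat using (ℕ; zero; suc; _+_; _∸_; _≤_; _<_; _≤ᵇ_; _≡ᵇ_)
open import Data.Nat.Properties using (_≤?_; _<?_)
open import Data.Bool using (Bool; true; false; _∧_; _∨_; not; if_then_else_)
open import Data.List using (List; []; _∷_; length; map; upTo; filterᵇ)
open import Data.Bool.ListAction using (all; any)
open import Data.Maybe using (Maybe; just; nothing)
open import Data.Product using (_×_; _,_; ∃-syntax; proj₁; proj₂)
open import Relation.Nullary using (does; Dec)
open import Relation.Nullary.Decidable using (_×-dec_)

-- A cell (row , column). Rows are 1..r, columns are r+1..r+c.
Cell : Set
Cell = ℕ × ℕ

-- The partitions λ and μ are given as functions lam mu : ℕ → ℕ,
-- lam i = λ_i, mu i = μ_i for rows 1 ≤ i ≤ r (other values irrelevant).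
-- λ/μ is a skew shape with r rows and c columns, every row and column nonempty.
record IsSkewShape (r c : ℕ) (lam mu : ℕ → ℕ) : Set where
  field
    lam-decr  : ∀ i j → 1 ≤ i → i ≤ j → j ≤ r → lam j ≤ lam i
    mu-decr   : ∀ i j → 1 ≤ i → i ≤ j → j ≤ r → mu j ≤ mu i
    rows-ne   : ∀ i → 1 ≤ i → i ≤ r → mu i < lam i
    within-c  : ∀ i → 1 ≤ i → i ≤ r → lam i ≤ c
    cols-ne   : ∀ j → 1 ≤ j → j ≤ c → ∃[ i ] (1 ≤ i × i ≤ r × mu i < j × j ≤ lam i)

InSkew : (r : ℕ) (lam mu : ℕ → ℕ) → Cell → Set
InSkew r lam mu (i , col) = 1 ≤ i × i ≤ r × r + mu i < col × col ≤ r + lam i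

inSkew? : (r : ℕ) (lam mu : ℕ → ℕ) (x : Cell) → Dec (InSkew r lam mu x)
inSkew? r lam mu (i , col) = (1 ≤? i) ×-dec (i ≤? r) ×-dec (r + mu i <? col) ×-dec (col ≤? r + lam i)

-- Adding a new rook (j , l) next to an existing rook (i , k) keeps the
-- placement non-attacking (different row and column) and non-nesting
-- (no i<j, k<l and no j<i, l<k).
compatible : Cell → Cell → Bool
compatible (j , l) (i , k) =
  not (i ≡ᵇ j) ∧ not (k ≡ᵇ l)
  ∧ not (does (i <? j) ∧ does (k <? l))
  ∧ not (does (j <? i) ∧ does (l <? k))

rightmost : (ℕ → Bool) → (base n : ℕ) → Maybe ℕ
rightmost p base zero = nothing
rightmost p base (suc n) =
  if p (base + suc n) then just (base + suc n) else rightmost p base n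

addRook : ℕ → Maybe ℕ → List Cell → List Cell
addRook j nothing  ρ = ρ
addRook j (just l) ρ = (j , l) ∷ ρ

-- The a-extremal non-nesting rook placement (a a column index),
-- restricted to rows 1..k: columns a, a+1, ..., r+c are kept unoccupied,
-- and for rows j = 1, ..., k in turn a rook is placed in row j as far right
-- as possible (if possible at all) keeping the configuration inside λ/μ,
-- non-attacking and non-nesting.
extremalUpTo : (r c : ℕ) (lam mu : ℕ → ℕ) (a : ℕ) → ℕ → List Cell
extremalUpTo r c lam mu a zero = []
extremalUpTo r c lam mu a (suc k) =
  let ρ = extremalUpTo r c lam mu a k
      j = suc k
      ok : ℕ → Bool
      ok l = does (inSkew? r lam mu (j , l)) ∧ does (l <? a) ∧ all (compatible (j , l)) ρ
  in addRook j (rightmost ok r c) ρ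

extremal : (r c : ℕ) (lam mu : ℕ → ℕ) (a : ℕ) → List Cell
extremal r c lam mu a = extremalUpTo r c lam mu a r

interval : ℕ → ℕ → List ℕ
interval m n = map (m +_) (upTo (suc n ∸ m))

rowOccupied : List Cell → ℕ → Bool
rowOccupied ρ x = any (λ cell → proj₁ cell ≡ᵇ x) ρ

colOccupied : List Cell → ℕ → Bool
colOccupied ρ x = any (λ cell → proj₂ cell ≡ᵇ x) ρ

inRC : (r c : ℕ) → List Cell → ℕ → Bool
inRC r c ρ x =
  ((1 ≤ᵇ x) ∧ (x ≤ᵇ r) ∧ rowOccupied ρ x)
  ∨ ((suc r ≤ᵇ x) ∧ (x ≤ᵇ r + c) ∧ not (colOccupied ρ x))

I : (r c : ℕ) (lam mu : ℕ → ℕ) (a : ℕ) → List ℕ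
I r c lam mu a = filterᵇ (inRC r c (extremal r c lam mu a)) (interval 1 (r + c))

ell : (r c : ℕ) (lam mu : ℕ → ℕ) (a b : ℕ) → ℕ
ell r c lam mu a b = length (filterᵇ (λ x → (1 ≤ᵇ x) ∧ (x ≤ᵇ b)) (I r c lam mu a))

{-# OPTIONS --safe #-}
-- Suppose (b, a−1) ∈ λ/μ. When the greedy construction of ρ_a reaches row b, either an earlier
-- row already holds a rook, or no rook has been placed yet; then nothing constrains row b and
-- (b, a−1) is an admissible cell left of column a, so row b receives a rook. Either way some row
-- in [1, b] is occupied, hence lies in I_a ∩ [1, b], contradicting ℓ_{a,b} = 0.
module Submission where

open import Defs
open import Data.Nat using (ℕ; _+_; _∸_; _≤_)
open import Data.Product using (_,_)
open import Relation.Binary.PropositionalEquality using (_≡_)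
open import Relation.Nullary using (¬_)

open import Data.Nat using (zero; suc; _<_; _≤′_; ≤′-refl; ≤′-step; s≤s; z≤n; z<s)
open import Data.Nat.Properties
open import Data.Bool using (Bool; true; false; T; _∧_)
open import Data.Unit using (tt)
open import Relation.Nullary using (does)
open import Data.Bool.Properties using (T-∧; T-∨; T?)
open import Data.Empty using (⊥-elim)
open import Data.List using (List; []; _∷_)
open import Data.List.Properties using (filter-some)
open import Data.List.Membership.Propositional using (_∈_; lose)
open import Data.List.Membership.Propositional.Properties using (∈-filter⁺; ∈-upTo⁺; ∈-map⁺)
open import Data.List.Relation.Binary.Subset.Propositional using (_⊆_)
open import Data.List.Relation.Unary.Any using (here; there)
open import Data.List.Relation.Unary.Any.Properties using (any⁺)
open import Data.Maybe using (just; nothing)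
open import Data.Product using (∃-syntax; proj₁; proj₂; _×_; map₂)
open import Data.Sum using (_⊎_; inj₁; inj₂)
open import Function using (id; _∘_; Equivalence)
open import Relation.Binary.PropositionalEquality using (refl; sym; trans; subst; cong; _≢_)
open import Relation.Nullary.Decidable using (dec-true)

open Equivalence using (from)

empty-or-inhabited : ∀ {A : Set} (xs : List A) → xs ≡ [] ⊎ ∃[ x ] x ∈ xs
empty-or-inhabited []      = inj₁ refl
empty-or-inhabited (x ∷ _) = inj₂ (x , here refl)

∈-interval : ∀ {x n} → 1 ≤ x → x ≤ n → x ∈ interval 1 n
∈-interval {suc x} _ x<n = ∈-map⁺ suc (∈-upTo⁺ x<n)

rightmost-just : (p : ℕ → Bool) (base n x : ℕ) → base < x → x ≤ base + n → T (p x) →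
  ∃[ l ] rightmost p base n ≡ just l
rightmost-just p base zero x base<x x≤base _ =
  ⊥-elim (<⇒≱ base<x (subst (x ≤_) (+-identityʳ base) x≤base))
rightmost-just p base (suc n) x base<x x≤top px with p (base + suc n) in p-top
... | true  = _ , refl
... | false = rightmost-just p base n x base<x x≤base+n px
  where
  x≢top : x ≢ base + suc n
  x≢top x≡top = subst T (trans (cong p x≡top) p-top) px
  x≤base+n : x ≤ base + n
  x≤base+n = ≤-pred (subst (x <_) (+-suc base n) (≤∧≢⇒< x≤top x≢top))

addRook-⊇ : ∀ {j m ρ} → ρ ⊆ addRook j m ρ
addRook-⊇ {m = nothing} = id
addRook-⊇ {m = just _}  = there

addRook-just : ∀ {j m ρ l} → m ≡ just l → (j , l) ∈ addRook j m ρ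
addRook-just refl = here refl

addRook-row : ∀ {j m ρ cell} → cell ∈ addRook j m ρ → proj₁ cell ≡ j ⊎ cell ∈ ρ
addRook-row {m = nothing} mem         = inj₂ mem
addRook-row {m = just _}  (here refl) = inj₁ refl
addRook-row {m = just _}  (there mem) = inj₂ mem

module _ (r c : ℕ) (lam mu : ℕ → ℕ) (a : ℕ) where

  extremalUpTo-mono′ : ∀ {k m} → k ≤′ m → extremalUpTo r c lam mu a k ⊆ extremalUpTo r c lam mu a m
  extremalUpTo-mono′ ≤′-refl        = id
  extremalUpTo-mono′ (≤′-step k≤′m) = addRook-⊇ ∘ extremalUpTo-mono′ k≤′m

  extremalUpTo-mono : ∀ {k m} → k ≤ m → extremalUpTo r c lam mu a k ⊆ extremalUpTo r c lam mu a m
  extremalUpTo-mono = extremalUpTo-mono′ ∘ ≤⇒≤′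

  extremalUpTo-row : ∀ k {cell} → cell ∈ extremalUpTo r c lam mu a k → 1 ≤ proj₁ cell × proj₁ cell ≤ k
  extremalUpTo-row (suc k) mem with addRook-row {j = suc k} mem
  ... | inj₁ row≡ = subst (λ i → 1 ≤ i × i ≤ suc k) (sym row≡) (s≤s z≤n , ≤-refl)
  ... | inj₂ mem′ = map₂ m≤n⇒m≤1+n (extremalUpTo-row k mem′)

  rook-in-row-after-empty : ∀ {k x} → extremalUpTo r c lam mu a k ≡ [] →
    InSkew r lam mu (suc k , x) → x < a → x ≤ r + c →
    ∃[ l ] (suc k , l) ∈ extremalUpTo r c lam mu a (suc k)
  rook-in-row-after-empty {k} {x} empty x∈λ/μ x<a x≤r+c rewrite empty
    with rightmost-just (λ l → does (inSkew? r lam mu (suc k , l)) ∧ does (l <? a) ∧ true) r c x r<x x≤r+c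
           x-fits
    where
    x-fits : T (does (inSkew? r lam mu (suc k , x)) ∧ does (x <? a) ∧ true)
    x-fits rewrite dec-true (inSkew? r lam mu (suc k , x)) x∈λ/μ | dec-true (x <? a) x<a = tt
    r<x : r < x
    r<x = ≤-<-trans (m≤m+n r (mu (suc k))) (proj₁ (proj₂ (proj₂ x∈λ/μ)))
  ... | l , found = l , addRook-just found

  extremalUpTo-nonempty : ∀ k {x} → InSkew r lam mu (suc k , x) → x < a → x ≤ r + c →
    ∃[ cell ] cell ∈ extremalUpTo r c lam mu a (suc k)
  extremalUpTo-nonempty k x∈λ/μ x<a x≤r+c with empty-or-inhabited (extremalUpTo r c lam mu a k)
  ... | inj₁ empty             = _ , proj₂ (rook-in-row-after-empty empty x∈λ/μ x<a x≤r+c)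
  ... | inj₂ (cell , ρₖ∋cell) = cell , addRook-⊇ ρₖ∋cell

  occupied-row-∈-I : ∀ {i j} → (i , j) ∈ extremal r c lam mu a → 1 ≤ i → i ≤ r → i ∈ I r c lam mu a
  occupied-row-∈-I {i} rook 1≤i i≤r =
    ∈-filter⁺ (T? ∘ inRC r c (extremal r c lam mu a)) (∈-interval 1≤i (≤-trans i≤r (m≤m+n r c)))
      (from T-∨ (inj₁ (from T-∧ (≤⇒≤ᵇ 1≤i , from T-∧ (≤⇒≤ᵇ i≤r , any⁺ _ (lose rook (≡⇒≡ᵇ i i refl)))))))

  ell-≢0 : ∀ {b x} → x ∈ I r c lam mu a → 1 ≤ x → x ≤ b → ell r c lam mu a b ≢ 0
  ell-≢0 x∈I 1≤x x≤b = n>0⇒n≢0 (filter-some (T? ∘ _) (lose x∈I (from T-∧ (≤⇒≤ᵇ 1≤x , ≤⇒≤ᵇ x≤b))))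

corollary3p11 : (r c : ℕ) (lam mu : ℕ → ℕ) → IsSkewShape r c lam mu →
    (a : ℕ) → r + 1 ≤ a → a ≤ r + c →
    (b : ℕ) → 1 ≤ b → b ≤ r →
    ell r c lam mu a b ≡ 0 → ¬ InSkew r lam mu (b , a ∸ 1)
corollary3p11 r c lam mu _ a r+1≤a a≤r+c (suc k) _ b≤r ell≡0 cell∈λ/μ
  with (_ , _) , rook ← extremalUpTo-nonempty r c lam mu a k cell∈λ/μ
                          (∸-monoʳ-< z<s (≤-trans (m≤n+m 1 r) r+1≤a)) (≤-trans (m∸n≤m a 1) a≤r+c)
  with 1≤i , i≤b ← extremalUpTo-row r c lam mu a (suc k) rook
  = ell-≢0 r c lam mu a
      (occupied-row-∈-I r c lam mu a (extremalUpTo-mono r c lam mu a b≤r rook) 1≤i (≤-trans i≤b b≤r))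
      1≤i i≤b ell≡0
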